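{- For every $n \geq 2$, $\mathrm{Av}_n[1342] = \{[\sigma] : \sigma \in \mathrm{Av}_n(213,231)\}$, where $\mathrm{Av}_n(213,231)$ is the set of permutations of $[n]$ that linearly avoid both $213$ and $231$.
   Context: A permutation $\sigma$ linearly contains $\pi$ if some subsequence of $\sigma$ is order-isomorphic to $\pi$, and linearly avoids it otherwise. A circular permutation $[\pi]$ of size $n$ is the set of all $n$ rotations of a permutation $\pi$ of $[n]$; $[\sigma]$ contains $[\pi]$ if some rotation of $\sigma$ linearly contains $\pi$, otherwise avoids it. $\mathrm{Av}_n[1342]$ is the set of circular permutations of size $n$ avoiding $[1342]$. -}

module Defs where

open import Data.Nat using (ℕ; zero; suc; _%_)
open import Data.Nat.DivMod using (m%n<n)
open import Data.Fin using (Fin; toℕ; fromℕ<; _<_)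
open import Data.Vec using (lookup; _∷_; [])
open import Data.Product using (Σ; ∃; _×_)
open import Relation.Nullary using (¬_)
open import Relation.Binary.PropositionalEquality using (_≡_)
open import Function.Definitions using (Injective)

-- A permutation of [n] is an injective (hence bijective) map Fin n → Fin n,
-- given in one-line notation: position i ↦ value σ i (0-indexed).
IsPerm : {n : ℕ} → (Fin n → Fin n) → Set
IsPerm σ = Injective _≡_ _≡_ σ

LContains : {n k : ℕ} → (Fin n → Fin n) → (Fin k → Fin k) → Set
LContains {n} {k} σ π =
  Σ (Fin k → Fin n) λ f →
    ((i j : Fin k) → i < j → f i < f j) ×
    ((i j : Fin k) → (σ (f i) < σ (f j) → π i < π j) × (π i < π j → σ (f i) < σ (f j)))

LAvoids : {n k : ℕ} → (Fin n → Fin n) → (Fin k → Fin k) → Set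
LAvoids σ π = ¬ LContains σ π

-- rotation of σ by r: the permutation σ(r+1) σ(r+2) ... σ(n) σ(1) ... σ(r)
rotate : (n : ℕ) → ℕ → (Fin n → Fin n) → Fin n → Fin n
rotate zero r σ ()
rotate (suc m) r σ i = σ (fromℕ< (m%n<n (toℕ i Data.Nat.+ r) (suc m)))

-- [σ] contains [π] iff some rotation of σ linearly contains π
CContains : {n k : ℕ} → (Fin n → Fin n) → (Fin k → Fin k) → Set
CContains {n} σ π = Σ ℕ λ r → (r Data.Nat.< n) × LContains (rotate n r σ) π

CAvoids : {n k : ℕ} → (Fin n → Fin n) → (Fin k → Fin k) → Set
CAvoids σ π = ¬ CContains σ π

SameCirc : {n : ℕ} → (Fin n → Fin n) → (Fin n → Fin n) → Set
SameCirc {n} σ τ = Σ ℕ λ r → (r Data.Nat.< n) × ((i : Fin n) → τ i ≡ rotate n r σ i)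

-- patterns (0-indexed one-line notation)
p1342 : Fin 4 → Fin 4
p1342 = lookup (Fin.zero ∷ Fin.suc (Fin.suc Fin.zero) ∷ Fin.suc (Fin.suc (Fin.suc Fin.zero)) ∷ Fin.suc Fin.zero ∷ [])

p213 : Fin 3 → Fin 3
p213 = lookup (Fin.suc Fin.zero ∷ Fin.zero ∷ Fin.suc (Fin.suc Fin.zero) ∷ [])

p231 : Fin 3 → Fin 3
p231 = lookup (Fin.suc Fin.zero ∷ Fin.suc (Fin.suc Fin.zero) ∷ Fin.zero ∷ [])

-- A permutation avoids 213 and 231 iff no entry lies strictly between two later
-- entries. Such a permutation contains no rotated 1342, since wherever the rotation
-- cuts an occurrence, one of its entries precedes two entries whose values enclose it.
-- Conversely, rotate a [1342]-avoider to start with its minimum 1, and let q be the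
-- position of its maximum n. Every entry before q is then smaller than every entry
-- after q (else 1, x, n, y is a 1342), and a between-configuration i < j < k not
-- straddling q yields a 1342 with the leading 1 or, cyclically, with n. So if the
-- entries before q increase, the permutation is between-free; a descent before q
-- instead forces the entries after q to decrease, and the rotation starting at n is
-- between-free.
module Submission where

open import Defs
open import Data.Nat using (ℕ; zero; suc; _+_; _∸_; _%_; _≤_; _<_; z≤n; s≤s; NonZero)
open import Data.Nat.Properties
open import Data.Nat.DivMod using (m%n<n; m%n%n≡m%n; n%n≡0; [m+n]%n≡m%n; m<n⇒m%n≡m; %-distribˡ-+)
open import Data.Fin using (Fin; zero; suc; #_; toℕ; fromℕ; fromℕ<; inject₁; punchOut)
  renaming (_<_ to _<ᶠ_; _≤_ to _≤ᶠ_)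
open import Data.Fin.Properties
  using (toℕ-injective; toℕ<n; toℕ-fromℕ; toℕ-fromℕ<; toℕ≤pred[n]; any?; injective⇒≤; punchOut-injective)
  renaming (_≟_ to _≟ᶠ_; _<?_ to _<ᶠ?_; <⇒≢ to <ᶠ⇒≢)
open import Data.Vec using (lookup; _∷_; [])
open import Data.Product using (Σ; _×_; _,_; proj₁; proj₂)
open import Data.Sum using (_⊎_; inj₁; inj₂)
open import Data.Empty using (⊥; ⊥-elim)
open import Relation.Nullary using (¬_; yes; no; Dec)
open import Relation.Nullary.Decidable using (_×-dec_)
open import Relation.Binary.PropositionalEquality
open import Relation.Binary.Definitions using (tri<; tri≈; tri>)
open import Function using (_∘_)
open import Function.Definitions using (Injective)

isPerm⇒surjective : ∀ {n} {σ : Fin n → Fin n} → IsPerm σ → ∀ v → Σ (Fin n) λ i → σ i ≡ v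
isPerm⇒surjective {suc n} {σ} σ-perm v with any? (λ i → σ i ≟ᶠ v)
... | yes found = found
... | no ¬found = ⊥-elim (1+n≰n (injective⇒≤ punchOut-σ-injective))
  where
  v≢σ : ∀ i → v ≢ σ i
  v≢σ i v≡σi = ¬found (i , sym v≡σi)
  punchOut-σ : Fin (suc n) → Fin n
  punchOut-σ i = punchOut (v≢σ i)
  punchOut-σ-injective : Injective _≡_ _≡_ punchOut-σ
  punchOut-σ-injective {i} {j} = σ-perm ∘ punchOut-injective (v≢σ i) (v≢σ j)

Ascending : ∀ {k} → (Fin (suc k) → ℕ) → Set
Ascending {k} f = (i : Fin k) → f (inject₁ i) < f (suc i)

ascending⇒strictMono : ∀ {k} (f : Fin (suc k) → ℕ) → Ascending f → ∀ {i j} → i <ᶠ j → f i < f j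
ascending⇒strictMono {suc k} f f↑ {zero} {suc zero} _ = f↑ zero
ascending⇒strictMono {suc k} f f↑ {zero} {suc (suc j)} _ =
  <-trans (f↑ zero) (ascending⇒strictMono (f ∘ suc) (f↑ ∘ suc) {zero} {suc j} (s≤s z≤n))
ascending⇒strictMono {suc k} f f↑ {suc i} {suc j} (s≤s i<j) =
  ascending⇒strictMono (f ∘ suc) (f↑ ∘ suc) i<j

-- ρ = π⁻¹ lists the positions of π by increasing value.
lContains-byAscent : ∀ {n k} (σ : Fin n → Fin n) {π : Fin (suc k) → Fin (suc k)}
  (ρ : Fin (suc k) → Fin (suc k)) → (∀ a → ρ (π a) ≡ a) → (f : Fin (suc k) → Fin n) →
  Ascending (toℕ ∘ f) → Ascending (toℕ ∘ σ ∘ f ∘ ρ) → LContains σ π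
lContains-byAscent σ {π} ρ ρ∘π f f↑ σf↑ =
  f , (λ a b → ascending⇒strictMono (toℕ ∘ f) f↑) , λ a b → reflect a b , preserve a b
  where
  w : Fin _ → ℕ
  w a = toℕ (σ (f a))
  preserve : ∀ a b → π a <ᶠ π b → σ (f a) <ᶠ σ (f b)
  preserve a b πa<πb =
    subst₂ (λ x y → w x < w y) (ρ∘π a) (ρ∘π b) (ascending⇒strictMono (w ∘ ρ) σf↑ πa<πb)
  reflect : ∀ a b → σ (f a) <ᶠ σ (f b) → π a <ᶠ π b
  reflect a b σfa<σfb with <-cmp (toℕ (π a)) (toℕ (π b))
  ... | tri< πa<πb _ _ = πa<πb
  ... | tri≈ _ πa≡πb _ = ⊥-elim (<-irrefl (cong w a≡b) σfa<σfb)
    where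
    a≡b : a ≡ b
    a≡b = trans (sym (ρ∘π a)) (trans (cong ρ (toℕ-injective πa≡πb)) (ρ∘π b))
  ... | tri> _ _ πb<πa = ⊥-elim (<-asym σfa<σfb (preserve b a πb<πa))

lContains-resp : ∀ {n k} {σ σ′ : Fin n → Fin n} {π : Fin k → Fin k} →
  (∀ i → σ i ≡ σ′ i) → LContains σ π → LContains σ′ π
lContains-resp σ≗σ′ (f , f-mono , iso) = f , f-mono , λ a b →
  (λ lt → proj₁ (iso a b) (subst₂ _<ᶠ_ (sym (σ≗σ′ (f a))) (sym (σ≗σ′ (f b))) lt)) ,
  (λ lt → subst₂ _<ᶠ_ (σ≗σ′ (f a)) (σ≗σ′ (f b)) (proj₂ (iso a b) lt))

p213⁻¹ p231⁻¹ : Fin 3 → Fin 3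
p213⁻¹ = lookup (# 1 ∷ # 0 ∷ # 2 ∷ [])
p231⁻¹ = lookup (# 2 ∷ # 0 ∷ # 1 ∷ [])

p1342⁻¹ : Fin 4 → Fin 4
p1342⁻¹ = lookup (# 0 ∷ # 3 ∷ # 1 ∷ # 2 ∷ [])

p213⁻¹∘p213 : ∀ a → p213⁻¹ (p213 a) ≡ a
p213⁻¹∘p213 zero = refl
p213⁻¹∘p213 (suc zero) = refl
p213⁻¹∘p213 (suc (suc zero)) = refl

p231⁻¹∘p231 : ∀ a → p231⁻¹ (p231 a) ≡ a
p231⁻¹∘p231 zero = refl
p231⁻¹∘p231 (suc zero) = refl
p231⁻¹∘p231 (suc (suc zero)) = refl

p1342⁻¹∘p1342 : ∀ a → p1342⁻¹ (p1342 a) ≡ a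
p1342⁻¹∘p1342 zero = refl
p1342⁻¹∘p1342 (suc zero) = refl
p1342⁻¹∘p1342 (suc (suc zero)) = refl
p1342⁻¹∘p1342 (suc (suc (suc zero))) = refl

Between : ∀ {n} → Fin n → Fin n → Fin n → Set
Between x y z = (y <ᶠ x × x <ᶠ z) ⊎ (z <ᶠ x × x <ᶠ y)

BetweenFree : ∀ {n} → (Fin n → Fin n) → Set
BetweenFree σ = ∀ {i j k} → i <ᶠ j → j <ᶠ k → ¬ Between (σ i) (σ j) (σ k)

below⇒¬between : ∀ {n} {x y z : Fin n} → x <ᶠ y → x <ᶠ z → ¬ Between x y z
below⇒¬between x<y _ (inj₁ (y<x , _)) = <-asym x<y y<x
below⇒¬between _ x<z (inj₂ (z<x , _)) = <-asym x<z z<x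

above⇒¬between : ∀ {n} {x y z : Fin n} → y <ᶠ x → z <ᶠ x → ¬ Between x y z
above⇒¬between _ z<x (inj₁ (_ , x<z)) = <-asym z<x x<z
above⇒¬between y<x _ (inj₂ (_ , x<y)) = <-asym y<x x<y

module _ {n : ℕ} {σ : Fin n → Fin n} where

  avoids⇒betweenFree : LAvoids σ p213 → LAvoids σ p231 → BetweenFree σ
  avoids⇒betweenFree av213 _ {i} {j} {k} i<j j<k (inj₁ (σj<σi , σi<σk)) =
    av213 (lContains-byAscent σ p213⁻¹ p213⁻¹∘p213 (lookup (i ∷ j ∷ k ∷ []))
      (λ { zero → i<j ; (suc zero) → j<k }) (λ { zero → σj<σi ; (suc zero) → σi<σk }))
  avoids⇒betweenFree _ av231 {i} {j} {k} i<j j<k (inj₂ (σk<σi , σi<σj)) =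
    av231 (lContains-byAscent σ p231⁻¹ p231⁻¹∘p231 (lookup (i ∷ j ∷ k ∷ []))
      (λ { zero → i<j ; (suc zero) → j<k }) (λ { zero → σk<σi ; (suc zero) → σi<σj }))

  betweenFree⇒avoids213 : BetweenFree σ → LAvoids σ p213
  betweenFree⇒avoids213 free (f , f-mono , iso) =
    free (f-mono (# 0) (# 1) (s≤s z≤n)) (f-mono (# 1) (# 2) (s≤s (s≤s z≤n)))
      (inj₁ (proj₂ (iso (# 1) (# 0)) (s≤s z≤n) , proj₂ (iso (# 0) (# 2)) (s≤s (s≤s z≤n))))

  betweenFree⇒avoids231 : BetweenFree σ → LAvoids σ p231
  betweenFree⇒avoids231 free (f , f-mono , iso) =
    free (f-mono (# 0) (# 1) (s≤s z≤n)) (f-mono (# 1) (# 2) (s≤s (s≤s z≤n)))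
      (inj₂ (proj₂ (iso (# 2) (# 0)) (s≤s z≤n) , proj₂ (iso (# 0) (# 1)) (s≤s (s≤s z≤n))))

  betweenFree-unordered : BetweenFree σ → ∀ {i j k} → i <ᶠ j → i <ᶠ k →
    σ j <ᶠ σ i → σ i <ᶠ σ k → ⊥
  betweenFree-unordered free {i} {j} {k} i<j i<k σj<σi σi<σk with <-cmp (toℕ j) (toℕ k)
  ... | tri< j<k _ _ = free i<j j<k (inj₁ (σj<σi , σi<σk))
  ... | tri≈ _ j≡k _ =
    <-asym σj<σi (subst (λ x → σ i <ᶠ σ x) (sym (toℕ-injective j≡k)) σi<σk)
  ... | tri> _ _ k<j = free i<k k<j (inj₂ (σj<σi , σi<σk))

[m%n+o]%n≡[m+o]%n : ∀ m o n .{{_ : NonZero n}} → (m % n + o) % n ≡ (m + o) % n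
[m%n+o]%n≡[m+o]%n m o n = begin
  (m % n + o) % n          ≡⟨ %-distribˡ-+ (m % n) o n ⟩
  (m % n % n + o % n) % n  ≡⟨ cong (λ x → (x + o % n) % n) (m%n%n≡m%n m n) ⟩
  (m % n + o % n) % n      ≡⟨ sym (%-distribˡ-+ m o n) ⟩
  (m + o) % n              ∎
  where open ≡-Reasoning

[m+o%n]%n≡[m+o]%n : ∀ m o n .{{_ : NonZero n}} → (m + o % n) % n ≡ (m + o) % n
[m+o%n]%n≡[m+o]%n m o n = begin
  (m + o % n) % n  ≡⟨ cong (_% n) (+-comm m (o % n)) ⟩
  (o % n + m) % n  ≡⟨ [m%n+o]%n≡[m+o]%n o m n ⟩
  (o + m) % n      ≡⟨ cong (_% n) (+-comm o m) ⟩
  (m + o) % n      ∎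
  where open ≡-Reasoning

module _ {m : ℕ} where
  private
    N : ℕ
    N = suc m

  -- rotate N r σ i reduces to σ (shift r i).
  shift : ℕ → Fin N → Fin N
  shift r i = fromℕ< (m%n<n (toℕ i + r) N)

  toℕ-shift : ∀ r i → toℕ (shift r i) ≡ (toℕ i + r) % N
  toℕ-shift r i = toℕ-fromℕ< _

  shift-shift : ∀ a b i → shift b (shift a i) ≡ shift ((a + b) % N) i
  shift-shift a b i = toℕ-injective (begin
    toℕ (shift b (shift a i))    ≡⟨ toℕ-shift b (shift a i) ⟩
    (toℕ (shift a i) + b) % N    ≡⟨ cong (λ x → (x + b) % N) (toℕ-shift a i) ⟩
    ((toℕ i + a) % N + b) % N    ≡⟨ [m%n+o]%n≡[m+o]%n (toℕ i + a) b N ⟩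
    (toℕ i + a + b) % N          ≡⟨ cong (_% N) (+-assoc (toℕ i) a b) ⟩
    (toℕ i + (a + b)) % N        ≡⟨ sym ([m+o%n]%n≡[m+o]%n (toℕ i) (a + b) N) ⟩
    (toℕ i + (a + b) % N) % N    ≡⟨ sym (toℕ-shift ((a + b) % N) i) ⟩
    toℕ (shift ((a + b) % N) i)  ∎)
    where open ≡-Reasoning

  shift-zero : ∀ i → shift 0 i ≡ i
  shift-zero i = toℕ-injective (begin
    toℕ (shift 0 i)   ≡⟨ toℕ-shift 0 i ⟩
    (toℕ i + 0) % N   ≡⟨ cong (_% N) (+-identityʳ (toℕ i)) ⟩
    toℕ i % N         ≡⟨ m<n⇒m%n≡m (toℕ<n i) ⟩
    toℕ i             ∎)
    where open ≡-Reasoning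

  shift-at-zero : ∀ x → shift (toℕ x) zero ≡ x
  shift-at-zero x = toℕ-injective (trans (toℕ-shift (toℕ x) zero) (m<n⇒m%n≡m (toℕ<n x)))

  unshift : ℕ → ℕ
  unshift r = (N ∸ r) % N

  unshift+r : ∀ {r} → r ≤ N → (unshift r + r) % N ≡ 0
  unshift+r {r} r≤N = begin
    ((N ∸ r) % N + r) % N  ≡⟨ [m%n+o]%n≡[m+o]%n (N ∸ r) r N ⟩
    (N ∸ r + r) % N        ≡⟨ cong (_% N) (m∸n+n≡m r≤N) ⟩
    N % N                  ≡⟨ n%n≡0 N ⟩
    0                      ∎
    where open ≡-Reasoning

  shift-unshift : ∀ {r} → r ≤ N → ∀ i → shift r (shift (unshift r) i) ≡ i
  shift-unshift {r} r≤N i = begin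
    shift r (shift (unshift r) i)    ≡⟨ shift-shift (unshift r) r i ⟩
    shift ((unshift r + r) % N) i    ≡⟨ cong (λ s → shift s i) (unshift+r r≤N) ⟩
    shift 0 i                        ≡⟨ shift-zero i ⟩
    i                                ∎
    where open ≡-Reasoning

  unshift-shift : ∀ {r} → r ≤ N → ∀ i → shift (unshift r) (shift r i) ≡ i
  unshift-shift {r} r≤N i = begin
    shift (unshift r) (shift r i)    ≡⟨ shift-shift r (unshift r) i ⟩
    shift ((r + unshift r) % N) i    ≡⟨ cong (λ s → shift (s % N) i) (+-comm r (unshift r)) ⟩
    shift ((unshift r + r) % N) i    ≡⟨ cong (λ s → shift s i) (unshift+r r≤N) ⟩
    shift 0 i                        ≡⟨ shift-zero i ⟩
    i                                ∎
    where open ≡-Reasoning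

  shift-injective : ∀ {r} → r ≤ N → Injective _≡_ _≡_ (shift r)
  shift-injective {r} r≤N {i} {j} eq =
    trans (sym (unshift-shift r≤N i)) (trans (cong (shift (unshift r)) eq) (unshift-shift r≤N j))

  toℕ-shift-fits : ∀ {r} i → toℕ i + r < N → toℕ (shift r i) ≡ toℕ i + r
  toℕ-shift-fits {r} i fits = trans (toℕ-shift r i) (m<n⇒m%n≡m fits)

  toℕ-shift-wraps : ∀ {r} i → r < N → N ≤ toℕ i + r → toℕ (shift r i) + N ≡ toℕ i + r
  toℕ-shift-wraps {r} i r<N wraps = begin
    toℕ (shift r i) + N        ≡⟨ cong (_+ N) (toℕ-shift r i) ⟩
    x % N + N                  ≡⟨ cong (λ y → y % N + N) (sym (m∸n+n≡m wraps)) ⟩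
    (x ∸ N + N) % N + N        ≡⟨ cong (_+ N) ([m+n]%n≡m%n (x ∸ N) N) ⟩
    (x ∸ N) % N + N            ≡⟨ cong (_+ N) (m<n⇒m%n≡m x∸N<N) ⟩
    x ∸ N + N                  ≡⟨ m∸n+n≡m wraps ⟩
    x                          ∎
    where
    open ≡-Reasoning
    x = toℕ i + r
    x∸N<N : x ∸ N < N
    x∸N<N = subst (x ∸ N <_) (m+n∸n≡m N N) (∸-monoˡ-< (+-mono-< (toℕ<n i) r<N) wraps)

  shift-<-fits : ∀ {r i j} → i <ᶠ j → toℕ j + r < N → shift r i <ᶠ shift r j
  shift-<-fits {r} {i} {j} i<j j-fits =
    subst₂ _<_ (sym (toℕ-shift-fits i i-fits)) (sym (toℕ-shift-fits j j-fits)) (+-monoˡ-< r i<j)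
    where
    i-fits : toℕ i + r < N
    i-fits = <-trans (+-monoˡ-< r i<j) j-fits

  shift-<-wraps : ∀ {r i j} → r < N → i <ᶠ j → N ≤ toℕ i + r → shift r i <ᶠ shift r j
  shift-<-wraps {r} {i} {j} r<N i<j i-wraps = +-cancelʳ-< N _ _
    (subst₂ _<_ (sym (toℕ-shift-wraps i r<N i-wraps)) (sym (toℕ-shift-wraps j r<N j-wraps))
      (+-monoˡ-< r i<j))
    where
    j-wraps : N ≤ toℕ j + r
    j-wraps = ≤-trans i-wraps (+-monoˡ-≤ r (<⇒≤ i<j))

  shift-wraps-< : ∀ {r} i → r < N → N ≤ toℕ i + r → toℕ (shift r i) < r
  shift-wraps-< {r} i r<N wraps = +-cancelʳ-< N _ _
    (subst₂ _<_ (sym (toℕ-shift-wraps i r<N wraps)) (+-comm N r) (+-monoˡ-< r (toℕ<n i)))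

  shift-wraps<fits : ∀ {r i j} → r < N → N ≤ toℕ j + r → toℕ i + r < N → shift r j <ᶠ shift r i
  shift-wraps<fits {r} {i} {j} r<N j-wraps i-fits =
    <-≤-trans (shift-wraps-< j r<N j-wraps) (subst (r ≤_) (sym (toℕ-shift-fits i i-fits)) (m≤n+m r (toℕ i)))

  -- from x y is the index of position y in the rotation starting at position x.
  from : Fin N → Fin N → Fin N
  from x = shift (unshift (toℕ x))

  toℕ-from : ∀ x y → toℕ (from x y) ≡ (toℕ y + (N ∸ toℕ x)) % N
  toℕ-from x y = trans (toℕ-shift _ y) ([m+o%n]%n≡[m+o]%n (toℕ y) (N ∸ toℕ x) N)

  toℕ-from-≥ : ∀ {x y} → x ≤ᶠ y → toℕ (from x y) ≡ toℕ y ∸ toℕ x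
  toℕ-from-≥ {x} {y} x≤y = begin
    toℕ (from x y)                     ≡⟨ toℕ-from x y ⟩
    (toℕ y + (N ∸ toℕ x)) % N          ≡⟨ cong (_% N) y+[N∸x]≡y∸x+N ⟩
    (toℕ y ∸ toℕ x + N) % N            ≡⟨ [m+n]%n≡m%n (toℕ y ∸ toℕ x) N ⟩
    (toℕ y ∸ toℕ x) % N                ≡⟨ m<n⇒m%n≡m (≤-<-trans (m∸n≤m (toℕ y) (toℕ x)) (toℕ<n y)) ⟩
    toℕ y ∸ toℕ x                      ∎
    where
    open ≡-Reasoning
    y+[N∸x]≡y∸x+N : toℕ y + (N ∸ toℕ x) ≡ toℕ y ∸ toℕ x + N
    y+[N∸x]≡y∸x+N = begin
      toℕ y + (N ∸ toℕ x)                  ≡⟨ cong (_+ (N ∸ toℕ x)) (sym (m∸n+n≡m x≤y)) ⟩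
      toℕ y ∸ toℕ x + toℕ x + (N ∸ toℕ x)  ≡⟨ +-assoc (toℕ y ∸ toℕ x) (toℕ x) (N ∸ toℕ x) ⟩
      toℕ y ∸ toℕ x + (toℕ x + (N ∸ toℕ x)) ≡⟨ cong (toℕ y ∸ toℕ x +_) (m+[n∸m]≡n (<⇒≤ (toℕ<n x))) ⟩
      toℕ y ∸ toℕ x + N                    ∎

  toℕ-from-< : ∀ {x y} → y <ᶠ x → toℕ (from x y) ≡ toℕ y + (N ∸ toℕ x)
  toℕ-from-< {x} {y} y<x = trans (toℕ-from x y) (m<n⇒m%n≡m y+[N∸x]<N)
    where
    y+[N∸x]<N : toℕ y + (N ∸ toℕ x) < N
    y+[N∸x]<N = subst (toℕ y + (N ∸ toℕ x) <_) (m+[n∸m]≡n (<⇒≤ (toℕ<n x)))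
      (+-monoˡ-< (N ∸ toℕ x) y<x)

  from-<-after : ∀ {x a b} → x ≤ᶠ a → a <ᶠ b → from x a <ᶠ from x b
  from-<-after {x} {a} {b} x≤a a<b =
    subst₂ _<_ (sym (toℕ-from-≥ x≤a)) (sym (toℕ-from-≥ (≤-trans x≤a (<⇒≤ a<b))))
    (∸-monoˡ-< a<b x≤a)

  from-<-before : ∀ {x a b} → a <ᶠ b → b <ᶠ x → from x a <ᶠ from x b
  from-<-before {x} {a} {b} a<b b<x = subst₂ _<_ (sym (toℕ-from-< (<-trans a<b b<x))) (sym (toℕ-from-< b<x))
    (+-monoˡ-< (N ∸ toℕ x) a<b)

  from-after<before : ∀ {x a b} → x ≤ᶠ a → b <ᶠ x → from x a <ᶠ from x b
  from-after<before {x} {a} {b} x≤a b<x = subst₂ _<_ (sym (toℕ-from-≥ x≤a)) (sym (toℕ-from-< b<x))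
    (<-≤-trans (∸-monoˡ-< (toℕ<n a) x≤a) (m≤n+m (N ∸ toℕ x) (toℕ b)))

  module _ {σ : Fin N → Fin N} where

    rotate-from : ∀ x y → rotate N (toℕ x) σ (from x y) ≡ σ y
    rotate-from x y = cong σ (shift-unshift (<⇒≤ (toℕ<n x)) y)

    rotate-isPerm : ∀ x → IsPerm σ → IsPerm (rotate N (toℕ x) σ)
    rotate-isPerm x σ-perm = shift-injective (<⇒≤ (toℕ<n x)) ∘ σ-perm

    sameCirc-rotate : ∀ x → SameCirc (rotate N (toℕ x) σ) σ
    sameCirc-rotate x = unshift (toℕ x) , m%n<n (N ∸ toℕ x) N ,
      λ i → cong σ (sym (shift-unshift (<⇒≤ (toℕ<n x)) i))

    sameCirc-trans : ∀ {ρ τ} → SameCirc σ ρ → SameCirc ρ τ → SameCirc σ τ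
    sameCirc-trans {ρ} {τ} (s , _ , ρ≡σ∘shift) (r , _ , τ≡ρ∘shift) =
      (r + s) % N , m%n<n (r + s) N , λ i → begin
        τ i                          ≡⟨ τ≡ρ∘shift i ⟩
        ρ (shift r i)                ≡⟨ ρ≡σ∘shift (shift r i) ⟩
        σ (shift s (shift r i))      ≡⟨ cong σ (shift-shift r s i) ⟩
        σ (shift ((r + s) % N) i)    ∎
      where open ≡-Reasoning

    cContains-rotation : ∀ {k} {τ : Fin N → Fin N} {π : Fin k → Fin k} r →
      (∀ i → τ i ≡ rotate N r σ i) → CContains τ π → CContains σ π
    cContains-rotation r τ≡ (s , _ , occurrence) = (s + r) % N , m%n<n (s + r) N ,
      lContains-resp (λ i → trans (τ≡ (shift s i)) (cong σ (shift-shift s r i))) occurrence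

    cContains-from : ∀ {k} {π : Fin (suc k) → Fin (suc k)} (ρ : Fin (suc k) → Fin (suc k)) →
      (∀ a → ρ (π a) ≡ a) → (x : Fin N) (p : Fin (suc k) → Fin N) →
      Ascending (toℕ ∘ from x ∘ p) → Ascending (toℕ ∘ σ ∘ p ∘ ρ) → CContains σ π
    cContains-from ρ ρ∘π x p keys↑ σp↑ =
      toℕ x , toℕ<n x , lContains-byAscent (rotate N (toℕ x) σ) ρ ρ∘π (from x ∘ p) keys↑ rotated↑
      where
      rotated↑ : Ascending (toℕ ∘ rotate N (toℕ x) σ ∘ from x ∘ p ∘ ρ)
      rotated↑ t = subst₂ (λ u v → toℕ u < toℕ v)
        (sym (rotate-from x (p (ρ (inject₁ t))))) (sym (rotate-from x (p (ρ (suc t))))) (σp↑ t)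

    linear1342 : ∀ {a b c d} → a <ᶠ b → b <ᶠ c → c <ᶠ d →
      σ a <ᶠ σ d → σ d <ᶠ σ b → σ b <ᶠ σ c → CContains σ p1342
    linear1342 {a} {b} {c} {d} a<b b<c c<d σa<σd σd<σb σb<σc =
      cContains-from p1342⁻¹ p1342⁻¹∘p1342 a (lookup (a ∷ b ∷ c ∷ d ∷ []))
        (λ { zero → from-<-after ≤-refl a<b
           ; (suc zero) → from-<-after (<⇒≤ a<b) b<c
           ; (suc (suc zero)) → from-<-after (<⇒≤ (<-trans a<b b<c)) c<d })
        (λ { zero → σa<σd ; (suc zero) → σd<σb ; (suc (suc zero)) → σb<σc })

    -- The occurrence is read from j around the circle: j, k, y, i.
    wrapped1342 : ∀ {i j k y} → i <ᶠ j → j <ᶠ k → (k <ᶠ y ⊎ y <ᶠ i) →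
      σ j <ᶠ σ i → σ i <ᶠ σ k → σ k <ᶠ σ y → CContains σ p1342
    wrapped1342 {i} {j} {k} {y} i<j j<k y-outside σj<σi σi<σk σk<σy =
      cContains-from p1342⁻¹ p1342⁻¹∘p1342 j (lookup (j ∷ k ∷ y ∷ i ∷ []))
        (λ { zero → from-<-after ≤-refl j<k
           ; (suc zero) → k<y y-outside
           ; (suc (suc zero)) → y<i y-outside })
        (λ { zero → σj<σi ; (suc zero) → σi<σk ; (suc (suc zero)) → σk<σy })
      where
      k<y : (k <ᶠ y ⊎ y <ᶠ i) → from j k <ᶠ from j y
      k<y (inj₁ k<y) = from-<-after (<⇒≤ j<k) k<y
      k<y (inj₂ y<i) = from-after<before (<⇒≤ j<k) (<-trans y<i i<j)
      y<i : (k <ᶠ y ⊎ y <ᶠ i) → from j y <ᶠ from j i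
      y<i (inj₁ k<y) = from-after<before (<⇒≤ (<-trans j<k k<y)) i<j
      y<i (inj₂ y<i) = from-<-before y<i i<j

-- The entries of the occurrence that wrapped around in the rotation come first in σ.
betweenFree⇒cAvoids1342 : ∀ {m} {σ : Fin (suc m) → Fin (suc m)} → BetweenFree σ → CAvoids σ p1342
betweenFree⇒cAvoids1342 {m} {σ} free (r , r<N , f , f-mono , iso) =
  cut (toℕ (f (# 1)) + r <? suc m) (toℕ (f (# 3)) + r <? suc m)
  where
  P : Fin 4 → Fin (suc m)
  P a = shift r (f a)
  f₀<f₁ : f (# 0) <ᶠ f (# 1)
  f₀<f₁ = f-mono (# 0) (# 1) (s≤s z≤n)
  f₁<f₂ : f (# 1) <ᶠ f (# 2)
  f₁<f₂ = f-mono (# 1) (# 2) (s≤s (s≤s z≤n))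
  f₂<f₃ : f (# 2) <ᶠ f (# 3)
  f₂<f₃ = f-mono (# 2) (# 3) (s≤s (s≤s (s≤s z≤n)))
  f₁<f₃ : f (# 1) <ᶠ f (# 3)
  f₁<f₃ = <-trans f₁<f₂ f₂<f₃
  σP₀<σP₃ : σ (P (# 0)) <ᶠ σ (P (# 3))
  σP₀<σP₃ = proj₂ (iso (# 0) (# 3)) (s≤s z≤n)
  σP₃<σP₁ : σ (P (# 3)) <ᶠ σ (P (# 1))
  σP₃<σP₁ = proj₂ (iso (# 3) (# 1)) (s≤s (s≤s z≤n))
  σP₁<σP₂ : σ (P (# 1)) <ᶠ σ (P (# 2))
  σP₁<σP₂ = proj₂ (iso (# 1) (# 2)) (s≤s (s≤s (s≤s z≤n)))
  cut : Dec (toℕ (f (# 1)) + r < suc m) → Dec (toℕ (f (# 3)) + r < suc m) → ⊥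
  cut (no f₁-wraps) _ =
    betweenFree-unordered free (shift-<-wraps r<N f₁<f₃ (≮⇒≥ f₁-wraps))
      (shift-<-wraps r<N f₁<f₂ (≮⇒≥ f₁-wraps)) σP₃<σP₁ σP₁<σP₂
  cut (yes _) (yes f₃-fits) =
    betweenFree-unordered free (shift-<-fits f₁<f₃ f₃-fits)
      (shift-<-fits f₁<f₂ (<-trans (+-monoˡ-< r f₂<f₃) f₃-fits)) σP₃<σP₁ σP₁<σP₂
  cut (yes f₁-fits) (no f₃-wraps) =
    betweenFree-unordered free
      (shift-wraps<fits r<N (≮⇒≥ f₃-wraps) (<-trans (+-monoˡ-< r f₀<f₁) f₁-fits))
      (shift-wraps<fits r<N (≮⇒≥ f₃-wraps) f₁-fits) σP₀<σP₃ σP₃<σP₁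

module MinFirst {m : ℕ} (σ : Fin (suc m) → Fin (suc m)) (σ-perm : IsPerm σ) (avoid : CAvoids σ p1342)
                (σ-zero : σ zero ≡ zero) (q : Fin (suc m)) (σ-q : σ q ≡ fromℕ m) where

  σ-ordered : ∀ {a b} → a ≢ b → ¬ σ b <ᶠ σ a → σ a <ᶠ σ b
  σ-ordered a≢b σb≮σa = ≤∧≢⇒< (≮⇒≥ σb≮σa) (λ eq → a≢b (σ-perm (toℕ-injective eq)))

  σ-min : ∀ {x} → 0 < toℕ x → σ zero <ᶠ σ x
  σ-min {x} 0<x = σ-ordered (λ 0≡x → <-irrefl (cong toℕ 0≡x) 0<x)
    (λ σx<σ0 → n≮0 (subst (toℕ (σ x) <_) (cong toℕ σ-zero) σx<σ0))

  σ-max : ∀ {x} → x ≢ q → σ x <ᶠ σ q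
  σ-max {x} x≢q = σ-ordered x≢q
    (λ σq<σx → <⇒≱ σq<σx (subst (toℕ (σ x) ≤_) (sym toℕσq≡m) (toℕ≤pred[n] (σ x))))
    where
    toℕσq≡m : toℕ (σ q) ≡ m
    toℕσq≡m = trans (cong toℕ σ-q) (toℕ-fromℕ m)

  rising-across-max : ∀ {a b} → a <ᶠ q → q <ᶠ b → σ a <ᶠ σ b
  rising-across-max {zero} _ q<b = σ-min (≤-<-trans z≤n q<b)
  rising-across-max {a@(suc _)} {b} a<q q<b = σ-ordered (<ᶠ⇒≢ (<-trans a<q q<b))
    (λ σb<σa → avoid (linear1342 (s≤s z≤n) a<q q<b (σ-min (≤-<-trans z≤n q<b)) σb<σa
                                 (σ-max (<ᶠ⇒≢ a<q))))

  no-between-beside-max : ∀ {i j k} → i <ᶠ j → j <ᶠ k → (k <ᶠ q ⊎ q <ᶠ i) →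
    ¬ Between (σ i) (σ j) (σ k)
  no-between-beside-max {zero} i<j j<k _ = below⇒¬between (σ-min i<j) (σ-min (<-trans i<j j<k))
  no-between-beside-max {i@(suc _)} {j} {k} i<j j<k q-outside (inj₁ (σj<σi , σi<σk)) =
    avoid (wrapped1342 i<j j<k q-outside σj<σi σi<σk (σ-max (k≢q q-outside)))
    where
    k≢q : k <ᶠ q ⊎ q <ᶠ i → k ≢ q
    k≢q (inj₁ k<q) = <ᶠ⇒≢ k<q
    k≢q (inj₂ q<i) = ≢-sym (<ᶠ⇒≢ (<-trans q<i (<-trans i<j j<k)))
  no-between-beside-max {suc _} i<j j<k _ (inj₂ (σk<σi , σi<σj)) =
    avoid (linear1342 (s≤s z≤n) i<j j<k (σ-min (<-trans (s≤s z≤n) (<-trans i<j j<k))) σk<σi σi<σj)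

  Descent : Set
  Descent = Σ (Fin (suc m)) λ a → Σ (Fin (suc m)) λ a′ → a <ᶠ a′ × a′ <ᶠ q × σ a′ <ᶠ σ a

  descent? : Dec Descent
  descent? = any? λ a → any? λ a′ → a <ᶠ? a′ ×-dec (a′ <ᶠ? q ×-dec σ a′ <ᶠ? σ a)

  rising-from-before-max : ¬ Descent → ∀ {a x} → a <ᶠ q → a <ᶠ x → σ a <ᶠ σ x
  rising-from-before-max ¬descent {a} {x} a<q a<x with <-cmp (toℕ x) (toℕ q)
  ... | tri< x<q _ _ = σ-ordered (<ᶠ⇒≢ a<x) (λ σx<σa → ¬descent (a , x , a<x , x<q , σx<σa))
  ... | tri≈ _ x≡q _ = subst (λ y → σ a <ᶠ σ y) (sym (toℕ-injective x≡q)) (σ-max (<ᶠ⇒≢ a<q))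
  ... | tri> _ _ q<x = rising-across-max a<q q<x

  betweenFree-without-descent : ¬ Descent → BetweenFree σ
  betweenFree-without-descent ¬descent {i} {j} {k} i<j j<k with <-cmp (toℕ i) (toℕ q)
  ... | tri< i<q _ _ = below⇒¬between (rising-from-before-max ¬descent i<q i<j)
    (rising-from-before-max ¬descent i<q (<-trans i<j j<k))
  ... | tri> _ _ q<i = no-between-beside-max i<j j<k (inj₂ q<i)
  ... | tri≈ _ i≡q _ with toℕ-injective i≡q
  ...   | refl = above⇒¬between (σ-max (≢-sym (<ᶠ⇒≢ i<j))) (σ-max (≢-sym (<ᶠ⇒≢ (<-trans i<j j<k))))

  falling-after-max : Descent → ∀ {b b′} → q <ᶠ b → b <ᶠ b′ → σ b′ <ᶠ σ b
  falling-after-max (a , a′ , a<a′ , a′<q , σa′<σa) q<b b<b′ = σ-ordered (≢-sym (<ᶠ⇒≢ b<b′))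
    (λ σb<σb′ → avoid (wrapped1342 a<a′ (<-trans a′<q q<b) (inj₁ b<b′) σa′<σa
                        (rising-across-max (<-trans a<a′ a′<q) q<b) σb<σb′))

  q<shift-fits : ∀ {i} → 0 < toℕ i → toℕ i + toℕ q < suc m → q <ᶠ shift (toℕ q) i
  q<shift-fits {i} 0<i i-fits = subst (toℕ q <_) (sym (toℕ-shift-fits i i-fits)) (+-monoˡ-< (toℕ q) 0<i)

  top-of-suffix-from-max : Descent → ∀ {i x} → toℕ i + toℕ q < suc m → i <ᶠ x →
    σ (shift (toℕ q) x) <ᶠ σ (shift (toℕ q) i)
  top-of-suffix-from-max _ {zero} {x} _ 0<x =
    subst (λ y → σ (shift (toℕ q) x) <ᶠ σ y) (sym (shift-at-zero q)) (σ-max Px≢q)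
    where
    Px≢q : shift (toℕ q) x ≢ q
    Px≢q Px≡q = <ᶠ⇒≢ 0<x (shift-injective (<⇒≤ (toℕ<n q)) (trans (shift-at-zero q) (sym Px≡q)))
  top-of-suffix-from-max descent {i@(suc _)} {x} i-fits i<x with toℕ x + toℕ q <? suc m
  ... | yes x-fits = falling-after-max descent (q<shift-fits (s≤s z≤n) i-fits) (shift-<-fits i<x x-fits)
  ... | no x-wraps =
    rising-across-max (shift-wraps-< x (toℕ<n q) (≮⇒≥ x-wraps)) (q<shift-fits (s≤s z≤n) i-fits)

  betweenFree-rotated-at-max : Descent → BetweenFree (rotate (suc m) (toℕ q) σ)
  betweenFree-rotated-at-max descent {i} {j} {k} i<j j<k with toℕ i + toℕ q <? suc m
  ... | yes i-fits = above⇒¬between (top-of-suffix-from-max descent i-fits i<j)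
    (top-of-suffix-from-max descent i-fits (<-trans i<j j<k))
  ... | no ¬i-fits = no-between-beside-max (shift-<-wraps q<N i<j i-wraps)
    (shift-<-wraps q<N j<k j-wraps) (inj₁ (shift-wraps-< k q<N k-wraps))
    where
    q<N : toℕ q < suc m
    q<N = toℕ<n q
    i-wraps : suc m ≤ toℕ i + toℕ q
    i-wraps = ≮⇒≥ ¬i-fits
    j-wraps : suc m ≤ toℕ j + toℕ q
    j-wraps = ≤-trans i-wraps (+-monoˡ-≤ (toℕ q) (<⇒≤ i<j))
    k-wraps : suc m ≤ toℕ k + toℕ q
    k-wraps = ≤-trans j-wraps (+-monoˡ-≤ (toℕ q) (<⇒≤ j<k))

rotation-betweenFree : ∀ {m} (τ : Fin (suc m) → Fin (suc m)) → IsPerm τ → CAvoids τ p1342 →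
  Σ (Fin (suc m) → Fin (suc m)) λ σ → IsPerm σ × BetweenFree σ × SameCirc σ τ
rotation-betweenFree {m} τ τ-perm τ-avoid = conclude descent?
  where
  p : Fin (suc m)
  p = proj₁ (isPerm⇒surjective τ-perm zero)
  σ : Fin (suc m) → Fin (suc m)
  σ = rotate (suc m) (toℕ p) τ
  σ-perm : IsPerm σ
  σ-perm = rotate-isPerm p τ-perm
  σ-zero : σ zero ≡ zero
  σ-zero = trans (cong τ (shift-at-zero p)) (proj₂ (isPerm⇒surjective τ-perm zero))
  σ-avoid : CAvoids σ p1342
  σ-avoid = τ-avoid ∘ cContains-rotation {σ = τ} (toℕ p) (λ _ → refl)
  q : Fin (suc m)
  q = proj₁ (isPerm⇒surjective σ-perm (fromℕ m))
  open MinFirst σ σ-perm σ-avoid σ-zero q (proj₂ (isPerm⇒surjective σ-perm (fromℕ m)))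
  conclude : Dec Descent →
    Σ (Fin (suc m) → Fin (suc m)) λ σ′ → IsPerm σ′ × BetweenFree σ′ × SameCirc σ′ τ
  conclude (no ¬descent) = σ , σ-perm , betweenFree-without-descent ¬descent , sameCirc-rotate p
  conclude (yes descent) = rotate (suc m) (toℕ q) σ , rotate-isPerm q σ-perm ,
    betweenFree-rotated-at-max descent ,
    sameCirc-trans {σ = rotate (suc m) (toℕ q) σ} {ρ = σ} (sameCirc-rotate q) (sameCirc-rotate {σ = τ} p)

theorem3p5 : (n : ℕ) → 2 ≤ n → (τ : Fin n → Fin n) → IsPerm τ →
    (CAvoids τ p1342 →
      Σ (Fin n → Fin n) λ σ → IsPerm σ × LAvoids σ p213 × LAvoids σ p231 × SameCirc σ τ)
    × ((Σ (Fin n → Fin n) λ σ → IsPerm σ × LAvoids σ p213 × LAvoids σ p231 × SameCirc σ τ) →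
      CAvoids τ p1342)
-- 2 ≤ n only serves to exclude n = 0, where no rotation exists.
theorem3p5 (suc m) _ τ τ-perm =
  (λ avoid → let σ , σ-perm , free , σ~τ = rotation-betweenFree τ τ-perm avoid
             in σ , σ-perm , betweenFree⇒avoids213 free , betweenFree⇒avoids231 free , σ~τ) ,
  λ { (σ , _ , av213 , av231 , r , _ , τ≡) →
        betweenFree⇒cAvoids1342 (avoids⇒betweenFree {σ = σ} av213 av231)
        ∘ cContains-rotation {σ = σ} r τ≡ }
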